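{- Let $G$ be a graph and $b:V(G)\to\mathbb{Z}_{\ge0}$ such that $G$ has a $b$-factor. Define relations $\sim^-_b$ and $\sim^+_b$ on $V(G)$ as follows: for $u,v\in V(G)$, $u\sim^-_b v$ (resp. $u\sim^+_b v$) if $u=v$, or if $u$ and $v$ are $b$-flexibly connected and $G$ has no $(b-\chi_u-\chi_v)$-factor (resp. no $(b+\chi_u+\chi_v)$-factor). Then $\sim^-_b$ and $\sim^+_b$ are equivalence relations on $V(G)$.
   Context: $G$ is a finite graph (parallel edges allowed). For $v\in V(G)$, $\delta(v)$ denotes the set of edges joining $v$ and $V(G)\setminus\{v\}$. For a map $c:V(G)\to\mathbb{Z}$, a $c$-factor (perfect $c$-matching) is a set $M\subseteq E(G)$ with $|\delta(v)\cap M|=c(v)$ for every $v\in V(G)$. For $u\in V(G)$, $\chi_u:V(G)\to\mathbb{Z}_{\ge0}$ is the map with $\chi_u(u)=1$ and $\chi_u(w)=0$ for $w\neq u$; sums and differences of maps are taken pointwise. Assume $G$ has a $b$-factor. An edge $e$ is $b$-allowed if some $b$-factor contains $e$, and $b$-flexible if it is $b$-allowed and some $b$-factor does not contain $e$. Vertices $u,v$ are $b$-flexibly connected if there is a path between $u$ and $v$ all of whose edges are $b$-flexible. -}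

module Defs where

open import Data.Nat using (ℕ; zero; suc)
open import Data.Integer using (ℤ; +_; _+_; _-_)
open import Data.Fin using (Fin)
open import Data.Fin.Properties using (_≟_)
open import Data.Bool using (Bool; true; false)
open import Data.Product using (_×_; _,_; proj₁; proj₂; Σ; ∃)
open import Data.Sum using (_⊎_)
open import Data.List using (List; []; _∷_; length; filter)
open import Data.List.Base using (allFin)
open import Data.List.Relation.Unary.All using (All)
open import Relation.Nullary using (¬_; Dec; yes; no)
open import Relation.Nullary.Decidable using (⌊_⌋)
open import Relation.Binary.PropositionalEquality using (_≡_; _≢_)

-- A finite multigraph (parallel edges and loops allowed):
-- vertex set Fin n, edge set Fin m, each edge has two endpoints.
record Graph : Set where
  field
    n    : ℕ
    m    : ℕ
    ends : Fin m → Fin n × Fin n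

open Graph public

V : Graph → Set
V G = Fin (n G)

E : Graph → Set
E G = Fin (m G)

-- e ∈ δ(v): e joins v and a vertex different from v (loops are never in δ(v)).
inδ : (G : Graph) → V G → E G → Bool
inδ G v e with ends G e
... | (x , y) with x ≟ v | y ≟ v
...   | yes _ | yes _ = false
...   | yes _ | no _  = true
...   | no _  | yes _ = true
...   | no _  | no _  = false

EdgeSet : Graph → Set
EdgeSet G = E G → Bool

degIn : (G : Graph) → EdgeSet G → V G → ℕ
degIn G M v = length (filter (λ e → Data.Bool._≟_ (Data.Bool._∧_ (M e) (inδ G v e)) true) (allFin (m G)))

IsFactor : (G : Graph) → (V G → ℤ) → EdgeSet G → Set
IsFactor G c M = (v : V G) → + (degIn G M v) ≡ c v

HasFactor : (G : Graph) → (V G → ℤ) → Set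
HasFactor G c = Σ (EdgeSet G) (IsFactor G c)

toℤ : (G : Graph) → (V G → ℕ) → V G → ℤ
toℤ G b v = + (b v)

χ : (G : Graph) → V G → V G → ℤ
χ G u w with u ≟ w
... | yes _ = + 1
... | no _  = + 0

_⊕_ : {A : Set} → (A → ℤ) → (A → ℤ) → A → ℤ
(f ⊕ g) x = f x + g x

_⊖_ : {A : Set} → (A → ℤ) → (A → ℤ) → A → ℤ
(f ⊖ g) x = f x - g x

Allowed : (G : Graph) → (V G → ℤ) → E G → Set
Allowed G c e = Σ (EdgeSet G) λ M → IsFactor G c M × M e ≡ true

Flexible : (G : Graph) → (V G → ℤ) → E G → Set
Flexible G c e = Allowed G c e × Σ (EdgeSet G) λ M → IsFactor G c M × M e ≡ false

data Path (G : Graph) (P : E G → Set) : V G → V G → Set where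
  [] : ∀ {u} → Path G P u u
  step : ∀ {u w v} (e : E G) →
         (ends G e ≡ (u , w) ⊎ ends G e ≡ (w , u)) →
         P e → Path G P w v → Path G P u v

FlexiblyConnected : (G : Graph) → (V G → ℤ) → V G → V G → Set
FlexiblyConnected G c u v = Path G (Flexible G c) u v

SimMinus : (G : Graph) → (V G → ℕ) → V G → V G → Set
SimMinus G b u v = u ≡ v ⊎
  (FlexiblyConnected G (toℤ G b) u v ×
   ¬ HasFactor G ((toℤ G b ⊖ χ G u) ⊖ χ G v))

SimPlus : (G : Graph) → (V G → ℕ) → V G → V G → Set
SimPlus G b u v = u ≡ v ⊎
  (FlexiblyConnected G (toℤ G b) u v ×
   ¬ HasFactor G ((toℤ G b ⊕ χ G u) ⊕ χ G v))

-- If M is an X-factor, N a Y-factor and X p > Y p, an alternating walk in M Δ N starting at p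
-- yields, for some q, an (X − χp − χq)-factor if X − χp still exceeds Y at q, or an
-- (X − χp + χq)-factor if it falls short of Y there. Around a flexible edge aa′, a few such
-- exchanges turn a (c − χv − χa)-factor and a (c − χa′ − χw)-factor into a (c − χv − χa′)-
-- or a (c − χv − χw)-factor. So the property "every lowerable pair {x, w} at the current
-- vertex x yields a lowerable pair at v" survives each flexible edge of a path from v, which
-- gives transitivity of ∼⁻. Complementation M ↦ E ∖ M turns c-factors into
-- (deg − c)-factors, so ∼⁺ for b is ∼⁻ for deg − b.

module Submission where

open import Defs
open import Data.Nat using (ℕ; zero; suc)
import Data.Nat as ℕ
import Data.Nat.Properties as ℕP
open import Data.Integer using (ℤ; +_; _+_; _-_; -_; _<_; _≤_; 0ℤ; 1ℤ)
import Data.Integer as ℤ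
import Data.Integer.Properties as ℤP
open import Data.Integer.Tactic.RingSolver using (solve-∀)
open import Data.Fin using (Fin; zero; suc)
open import Data.Fin.Properties using (_≟_; suc-injective)
open import Data.Bool using (Bool; true; false; not; _∧_; _xor_; if_then_else_)
import Data.Bool as Bool
open import Data.Bool.Properties using (not-involutive; xor-same; not-distribʳ-xor)
open import Data.Sign using (Sign; opposite)
import Data.Sign as Sign
open import Data.Product using (_×_; _,_; Σ; map)
open import Data.Sum using (_⊎_; inj₁; inj₂; reduce; swap)
open import Data.List using (length; filter; tabulate)
open import Data.Empty using (⊥-elim)
open import Function using (_∘_; id)
open import Relation.Nullary using (¬_; Dec; yes; no; does)
open import Relation.Binary.PropositionalEquality
open import Relation.Binary.Definitions using (Symmetric; Transitive)
open import Relation.Binary.Structures using (IsEquivalence)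
open import Relation.Binary.Construct.Closure.Reflexive using (ReflClosure; refl; [_])

indicator : Bool → ℕ
indicator true  = 1
indicator false = 0

count : ∀ k → (Fin k → Bool) → ℕ
count zero    f = 0
count (suc k) f = indicator (f zero) ℕ.+ count k (f ∘ suc)

count-cong : ∀ {k} {f g : Fin k → Bool} → f ≗ g → count k f ≡ count k g
count-cong {zero}  f≗g = refl
count-cong {suc k} f≗g = cong₂ ℕ._+_ (cong indicator (f≗g zero)) (count-cong (f≗g ∘ suc))

count-update : ∀ {k} {f g : Fin k → Bool} i → f i ≡ false → (∀ j → j ≢ i → f j ≡ g j) →
               count k g ≡ count k f ℕ.+ indicator (g i)
count-update {suc k} {f} {g} zero fi≡false agree rewrite fi≡false =
  trans (cong (indicator (g zero) ℕ.+_) (sym (count-cong λ j → agree (suc j) λ ())))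
        (ℕP.+-comm (indicator (g zero)) _)
count-update {suc k} {f} {g} (suc i) fi≡false agree rewrite agree zero (λ ()) =
  trans (cong (indicator (g zero) ℕ.+_)
              (count-update i fi≡false λ j j≢i → agree (suc j) (j≢i ∘ suc-injective)))
        (sym (ℕP.+-assoc (indicator (g zero)) _ _))

count-<-witness : ∀ {k} (f g : Fin k → Bool) → count k g ℕ.< count k f →
                  Σ (Fin k) λ i → f i ≡ true × g i ≡ false
count-<-witness {suc k} f g g<f with f zero in fz | g zero in gz
... | true  | false = zero , fz , gz
... | true  | true  = map suc id (count-<-witness (f ∘ suc) (g ∘ suc) (ℕ.s<s⁻¹ g<f))
... | false | false = map suc id (count-<-witness (f ∘ suc) (g ∘ suc) g<f)
... | false | true  = map suc id (count-<-witness (f ∘ suc) (g ∘ suc) (ℕP.<-trans (ℕP.n<1+n _) g<f))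

count-partition : ∀ {k} (f g : Fin k → Bool) →
                  count k (λ i → not (f i) ∧ g i) ℕ.+ count k (λ i → f i ∧ g i) ≡ count k g
count-partition {zero}  f g = refl
count-partition {suc k} f g with f zero | g zero | count-partition (f ∘ suc) (g ∘ suc)
... | true  | true  | ih = trans (ℕP.+-suc _ _) (cong suc ih)
... | false | true  | ih = cong suc ih
... | true  | false | ih = ih
... | false | false | ih = ih

length-filter-tabulate : ∀ {K} k (f : Fin k → Fin K) (P : Fin K → Bool) →
  length (filter (λ x → P x Bool.≟ true) (tabulate f)) ≡ count k (P ∘ f)
length-filter-tabulate zero    f P = refl
length-filter-tabulate (suc k) f P with P (f zero) | length-filter-tabulate k (f ∘ suc) P
... | true  | ih = cong suc ih
... | false | ih = ih

infixl 6 _±[_]_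
_±[_]_ : ℤ → Sign → ℤ → ℤ
x ±[ Sign.+ ] y = x + y
x ±[ Sign.- ] y = x - y

removes : Sign → Bool
removes Sign.- = true
removes Sign.+ = false

-- x <[ σ ] y : a step from x in direction σ moves toward y.
infix 4 _<[_]_ _<[_]?_
_<[_]_ : ℤ → Sign → ℤ → Set
x <[ Sign.+ ] y = x < y
x <[ Sign.- ] y = y < x

_<[_]?_ : ∀ x σ y → Dec (x <[ σ ] y)
x <[ Sign.+ ]? y = x ℤ.<? y
x <[ Sign.- ]? y = y ℤ.<? x

overshoot : ∀ σ {x y} → ¬ x <[ σ ] y → x ±[ σ ] 1ℤ <[ opposite σ ] y
overshoot Sign.+ {x} {y} x≮y =
  subst (_< x + 1ℤ) (ℤP.+-identityʳ y) (ℤP.+-mono-≤-< (ℤP.≮⇒≥ x≮y) (ℤ.+<+ (ℕ.s≤s ℕ.z≤n)))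
overshoot Sign.- {x} {y} y≮x =
  subst (x - 1ℤ <_) (ℤP.+-identityʳ y) (ℤP.+-mono-≤-< (ℤP.≮⇒≥ y≮x) ℤ.-<+)

one-below : ∀ {x y} → (x - 1ℤ) - y ≡ 0ℤ → y < x
one-below {x} {y} eq = ℤP.suc[i]≤j⇒i<j (ℤP.≤-reflexive (begin
  1ℤ + y                         ≡⟨ cong (λ t → (t + 1ℤ) + y) eq ⟨
  (((x - 1ℤ) - y) + 1ℤ) + y       ≡⟨ restore x y ⟩
  x                               ∎))
  where
  open ≡-Reasoning
  restore : ∀ x y → (((x - 1ℤ) - y) + 1ℤ) + y ≡ x
  restore = solve-∀

module _ (G : Graph) where

  χ-self : (x : V G) → χ G x x ≡ 1ℤ
  χ-self x with x ≟ x
  ... | yes _   = refl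
  ... | no x≢x = ⊥-elim (x≢x refl)

  χ-≢ : ∀ {x y : V G} → x ≢ y → χ G x y ≡ 0ℤ
  χ-≢ {x} {y} x≢y with x ≟ y
  ... | yes x≡y = ⊥-elim (x≢y x≡y)
  ... | no _    = refl

  Joins : E G → V G → V G → Set
  Joins e x y = ends G e ≡ (x , y) ⊎ ends G e ≡ (y , x)

  shift : Sign → (V G → ℤ) → V G → V G → ℤ
  shift σ c x z = c z ±[ σ ] χ G x z

  infixl 6 _⊕χ_ _⊖χ_
  _⊕χ_ _⊖χ_ : (V G → ℤ) → V G → V G → ℤ
  c ⊕χ x = shift Sign.+ c x
  c ⊖χ x = shift Sign.- c x

  IsFactor-cong : ∀ {c c′ M} → c ≗ c′ → IsFactor G c M → IsFactor G c′ M
  IsFactor-cong c≗c′ F z = trans (F z) (c≗c′ z)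

  HasFactor-cong : ∀ {c c′} → c ≗ c′ → HasFactor G c → HasFactor G c′
  HasFactor-cong c≗c′ (M , F) = M , IsFactor-cong c≗c′ F

  degIn≡count : ∀ M v → degIn G M v ≡ count (m G) (λ e → M e ∧ inδ G v e)
  degIn≡count M v = length-filter-tabulate (m G) id (λ e → M e ∧ inδ G v e)

  degIn-cong : ∀ {M M′} → M ≗ M′ → ∀ v → degIn G M v ≡ degIn G M′ v
  degIn-cong {M} {M′} M≗M′ v = begin
    degIn G M v                                ≡⟨ degIn≡count M v ⟩
    count (m G) (λ e → M e ∧ inδ G v e)        ≡⟨ count-cong (λ e → cong (_∧ inδ G v e) (M≗M′ e)) ⟩
    count (m G) (λ e → M′ e ∧ inδ G v e)       ≡⟨ degIn≡count M′ v ⟨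
    degIn G M′ v                               ∎
    where open ≡-Reasoning

  toggle : EdgeSet G → E G → EdgeSet G
  toggle M e f = if does (f ≟ e) then not (M f) else M f

  toggle-self : ∀ M e → toggle M e e ≡ not (M e)
  toggle-self M e with e ≟ e
  ... | yes _   = refl
  ... | no e≢e = ⊥-elim (e≢e refl)

  toggle-other : ∀ M {e f} → f ≢ e → toggle M e f ≡ M f
  toggle-other M {e} {f} f≢e with f ≟ e
  ... | yes f≡e = ⊥-elim (f≢e f≡e)
  ... | no _    = refl

  toggle-involutive : ∀ M e → toggle (toggle M e) e ≗ M
  toggle-involutive M e f with f ≟ e
  ... | yes refl = not-involutive (M e)
  ... | no _     = refl

  degIn-toggle-absent : ∀ {M e} → M e ≡ false → ∀ v →
                        degIn G (toggle M e) v ≡ degIn G M v ℕ.+ indicator (inδ G v e)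
  degIn-toggle-absent {M} {e} Me≡false v = begin
    degIn G (toggle M e) v                                           ≡⟨ degIn≡count (toggle M e) v ⟩
    count (m G) (λ f → toggle M e f ∧ inδ G v f)
      ≡⟨ count-update e (cong (_∧ inδ G v e) Me≡false) agree ⟩
    count (m G) (λ f → M f ∧ inδ G v f) ℕ.+ indicator (toggle M e e ∧ inδ G v e)
      ≡⟨ cong₂ ℕ._+_ (sym (degIn≡count M v)) (cong (λ b → indicator (b ∧ inδ G v e)) toggled) ⟩
    degIn G M v ℕ.+ indicator (inδ G v e)                            ∎
    where
    open ≡-Reasoning
    toggled : toggle M e e ≡ true
    toggled = trans (toggle-self M e) (cong not Me≡false)
    agree : ∀ f → f ≢ e → M f ∧ inδ G v f ≡ toggle M e f ∧ inδ G v f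
    agree f f≢e = cong (_∧ inδ G v f) (sym (toggle-other M f≢e))

  degIn-toggle-present : ∀ {M e} → M e ≡ true → ∀ v →
                         degIn G M v ≡ degIn G (toggle M e) v ℕ.+ indicator (inδ G v e)
  degIn-toggle-present {M} {e} Me≡true v =
    trans (degIn-cong (sym ∘ toggle-involutive M e) v)
          (degIn-toggle-absent (trans (toggle-self M e) (cong not Me≡true)) v)

  inδ-ends : ∀ {e x y} → ends G e ≡ (x , y) → x ≢ y → ∀ z →
             + indicator (inδ G z e) ≡ χ G x z + χ G y z
  inδ-ends {e} {x} {y} ends≡ x≢y z with ends G e | ends≡
  ... | _ | refl with x ≟ z | y ≟ z
  ... | yes refl | yes refl = ⊥-elim (x≢y refl)
  ... | yes _    | no _     = refl
  ... | no _     | yes _    = refl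
  ... | no _     | no _     = refl

  inδ-joins : ∀ {e x y} → Joins e x y → x ≢ y → ∀ z →
              + indicator (inδ G z e) ≡ χ G x z + χ G y z
  inδ-joins (inj₁ ends≡) x≢y z = inδ-ends ends≡ x≢y z
  inδ-joins {x = x} {y} (inj₂ ends≡) x≢y z =
    trans (inδ-ends ends≡ (x≢y ∘ sym) z) (ℤP.+-comm (χ G y z) (χ G x z))

  inδ-endpoint : ∀ {p e} → inδ G p e ≡ true → Σ (V G) λ q → q ≢ p × Joins e p q
  inδ-endpoint {p} {e} p∈δe with ends G e
  ... | x , y with x ≟ p | y ≟ p
  ... | yes refl | no y≢p = y , y≢p , inj₁ refl
  ... | no x≢p | yes refl = x , x≢p , inj₂ refl

  toggle-factor : ∀ σ {c M e x y} → IsFactor G c M → M e ≡ removes σ → Joins e x y → x ≢ y →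
                  IsFactor G (shift σ (shift σ c x) y) (toggle M e)
  toggle-factor Sign.+ {c} {M} {e} {x} {y} F Me joins x≢y z = begin
    + degIn G (toggle M e) z                   ≡⟨ cong +_ (degIn-toggle-absent Me z) ⟩
    + degIn G M z + + indicator (inδ G z e)    ≡⟨ cong₂ _+_ (F z) (inδ-joins joins x≢y z) ⟩
    c z + (χ G x z + χ G y z)                  ≡⟨ ℤP.+-assoc (c z) _ _ ⟨
    (c z + χ G x z) + χ G y z                  ∎
    where open ≡-Reasoning
  toggle-factor Sign.- {c} {M} {e} {x} {y} F Me joins x≢y z = begin
    + degIn G (toggle M e) z
      ≡⟨ add-subtract (+ degIn G (toggle M e) z) (χ G x z) (χ G y z) ⟩
    ((+ degIn G (toggle M e) z + (χ G x z + χ G y z)) - χ G x z) - χ G y z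
      ≡⟨ cong (λ d → (d - χ G x z) - χ G y z) degree-before ⟩
    (c z - χ G x z) - χ G y z ∎
    where
    open ≡-Reasoning
    add-subtract : ∀ d s t → d ≡ ((d + (s + t)) - s) - t
    add-subtract = solve-∀
    degree-before : + degIn G (toggle M e) z + (χ G x z + χ G y z) ≡ c z
    degree-before = begin
      + degIn G (toggle M e) z + (χ G x z + χ G y z)
        ≡⟨ cong (_+_ (+ degIn G (toggle M e) z)) (inδ-joins joins x≢y z) ⟨
      + degIn G (toggle M e) z + + indicator (inδ G z e)     ≡⟨ cong +_ (degIn-toggle-present Me z) ⟨
      + degIn G M z                                          ≡⟨ F z ⟩
      c z                                                    ∎

  distance : EdgeSet G → EdgeSet G → ℕ
  distance M N = count (m G) (λ e → M e xor N e)

  distance-toggle : ∀ {M N e} → N e ≡ not (M e) → distance M N ≡ suc (distance (toggle M e) N)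
  distance-toggle {M} {N} {e} Ne = trans
    (count-update e toggled-agrees agree)
    (trans (cong (distance (toggle M e) N ℕ.+_) (cong indicator differs)) (ℕP.+-comm _ 1))
    where
    toggled-agrees : toggle M e e xor N e ≡ false
    toggled-agrees rewrite toggle-self M e | Ne = xor-same (not (M e))
    differs : M e xor N e ≡ true
    differs rewrite Ne = trans (sym (not-distribʳ-xor (M e) (M e))) (cong not (xor-same (M e)))
    agree : ∀ f → f ≢ e → toggle M e f xor N f ≡ M f xor N f
    agree f f≢e = cong (_xor N f) (toggle-other M f≢e)

  degree-gap-edge : ∀ {M N p} → degIn G N p ℕ.< degIn G M p →
                    Σ (E G) λ e → inδ G p e ≡ true × M e ≡ true × N e ≡ false
  degree-gap-edge {M} {N} {p} N<M
    with count-<-witness (λ e → M e ∧ inδ G p e) (λ e → N e ∧ inδ G p e)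
           (subst₂ ℕ._<_ (degIn≡count N p) (degIn≡count M p) N<M)
  ... | e , M∧δ , N∧δ with M e in Me | inδ G p e in p∈δe | N e in Ne
  ... | true | true | false = e , p∈δe , Me , Ne

  differing-edge : ∀ σ {X Y M N p} → IsFactor G X M → IsFactor G Y N → X p <[ σ ] Y p →
                   Σ (E G) λ e → inδ G p e ≡ true × M e ≡ removes σ × N e ≡ not (removes σ)
  differing-edge Sign.- {p = p} FM FN Y<X =
    degree-gap-edge (ℤP.drop‿+<+ (subst₂ _<_ (sym (FN p)) (sym (FM p)) Y<X))
  differing-edge Sign.+ {p = p} FM FN X<Y with degree-gap-edge (ℤP.drop‿+<+ (subst₂ _<_ (sym (FM p)) (sym (FN p)) X<Y))
  ... | e , p∈δe , Ne , Me = e , p∈δe , Me , Ne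

  shift-cancel : ∀ σ c x → shift (opposite σ) (shift σ c x) x ≗ c
  shift-cancel Sign.+ c x z = add-subtract (c z) (χ G x z)
    where add-subtract : ∀ a b → (a + b) - b ≡ a
          add-subtract = solve-∀
  shift-cancel Sign.- c x z = subtract-add (c z) (χ G x z)
    where subtract-add : ∀ a b → (a - b) + b ≡ a
          subtract-add = solve-∀

  shift-self : ∀ σ c x → shift σ c x x ≡ c x ±[ σ ] 1ℤ
  shift-self σ c x = cong (c x ±[ σ ]_) (χ-self x)

  StepToward : (X Y : V G → ℤ) → Set
  StepToward X Y = Σ (V G) λ q → Σ Sign λ τ → HasFactor G (shift τ X q) × X q <[ τ ] Y q

  StepToward-cong : ∀ {X X′ Y} → X ≗ X′ → StepToward X Y → StepToward X′ Y
  StepToward-cong {Y = Y} X≗X′ (q , τ , F , X<Y) =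
    q , τ , HasFactor-cong (λ z → cong (_±[ τ ] χ G q z) (X≗X′ z)) F , subst (_<[ τ ] Y q) (X≗X′ q) X<Y

  alternating-step : ∀ σ {X Y M N p} → IsFactor G X M → IsFactor G Y N → X p <[ σ ] Y p →
    Σ (V G) λ q → Σ (EdgeSet G) λ M′ →
      IsFactor G (shift σ (shift σ X p) q) M′ × distance M N ≡ suc (distance M′ N)
  alternating-step σ {M = M} {N} FM FN X<Y with differing-edge σ FM FN X<Y
  ... | e , p∈δe , Me , Ne with inδ-endpoint p∈δe
  ... | q , q≢p , joins =
    q , toggle M e , toggle-factor σ FM Me joins (q≢p ∘ sym) , distance-toggle (trans Ne (cong not (sym Me)))

  -- Toggling an edge of M Δ N at p moves p and its other end q in direction σ; if this
  -- overshoots Y at q, the walk continues from q in the opposite direction.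
  exchange-within : ∀ d σ {X Y M N} p → distance M N ≡ d → IsFactor G X M → IsFactor G Y N →
                    X p <[ σ ] Y p → StepToward (shift σ X p) Y
  exchange-within d σ {X} {Y} p dist FM FN X<Y with alternating-step σ FM FN X<Y
  ... | q , M′ , FM′ , dist′ with shift σ X p q <[ σ ]? Y q | d | trans (sym dist) dist′
  ... | yes X′<Y | _      | _  = q , σ , (M′ , FM′) , X′<Y
  ... | no _     | zero   | ()
  ... | no X′≮Y  | suc d′ | d≡ =
    StepToward-cong (shift-cancel σ (shift σ X p) q)
      (exchange-within d′ (opposite σ) q (ℕP.suc-injective (sym d≡)) FM′ FN X″<Y)
    where
    X″<Y : shift σ (shift σ X p) q q <[ opposite σ ] Y q
    X″<Y = subst (_<[ opposite σ ] Y q) (sym (shift-self σ (shift σ X p) q)) (overshoot σ X′≮Y)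

  exchange : ∀ σ {X Y M N} p → IsFactor G X M → IsFactor G Y N →
             X p <[ σ ] Y p → StepToward (shift σ X p) Y
  exchange σ p = exchange-within _ σ p refl

  GapStep : (X′ g : V G → ℤ) → Set
  GapStep X′ g = Σ (V G) λ q → Σ Sign λ τ → HasFactor G (shift τ X′ q) × g q <[ τ ] 0ℤ

  -- g is (X − χp) − Y written in terms of the χ's, so that its sign at q pins q down.
  exchange-gap : ∀ {X Y M N} p (g : V G → ℤ) → IsFactor G X M → IsFactor G Y N →
    (∀ z → (X ⊖χ p) z - Y z ≡ g z) → g p ≡ 0ℤ → GapStep (X ⊖χ p) g
  exchange-gap {X} {Y} p g FM FN gap g[p]≡0 = gap-sign (exchange Sign.- p FM FN Y<X)
    where
    Y<X : Y p < X p
    Y<X = one-below (trans (cong (λ t → (X p - t) - Y p) (sym (χ-self p))) (trans (gap p) g[p]≡0))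
    gap-sign : StepToward (X ⊖χ p) Y → GapStep (X ⊖χ p) g
    gap-sign (q , Sign.- , F , Y<X′) =
      q , Sign.- , F , subst₂ _<_ (ℤP.+-inverseʳ (Y q)) (gap q) (ℤP.+-monoˡ-< (- Y q) Y<X′)
    gap-sign (q , Sign.+ , F , X′<Y) =
      q , Sign.+ , F , subst₂ _<_ (gap q) (ℤP.+-inverseʳ (Y q)) (ℤP.+-monoˡ-< (- Y q) X′<Y)

  0≤2χ+χ : ∀ x y q → 0ℤ ≤ (χ G x q + χ G x q) + χ G y q
  0≤2χ+χ x y q with x ≟ q | y ≟ q
  ... | yes _ | yes _ = ℤ.+≤+ ℕ.z≤n
  ... | yes _ | no _  = ℤ.+≤+ ℕ.z≤n
  ... | no _  | yes _ = ℤ.+≤+ ℕ.z≤n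
  ... | no _  | no _  = ℤ.+≤+ ℕ.z≤n

  0<2χ+χ⇒≡ : ∀ x y q → 0ℤ < (χ G x q + χ G x q) + χ G y q → x ≡ q ⊎ y ≡ q
  0<2χ+χ⇒≡ x y q _ with x ≟ q | y ≟ q
  ... | yes x≡q | _     = inj₁ x≡q
  ... | no _    | yes y≡q = inj₂ y≡q
  0<2χ+χ⇒≡ x y q (ℤ.+<+ ()) | no _ | no _

  0<2χ-χ⇒≡ : ∀ x y q → 0ℤ < (χ G x q + χ G x q) - χ G y q → x ≡ q
  0<2χ-χ⇒≡ x y q _ with x ≟ q | y ≟ q
  ... | yes x≡q | _ = x≡q
  0<2χ-χ⇒≡ x y q () | no _ | yes _
  0<2χ-χ⇒≡ x y q (ℤ.+<+ ()) | no _ | no _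

  2χ-χ<0⇒≡ : ∀ x y q → (χ G x q + χ G x q) - χ G y q < 0ℤ → y ≡ q
  2χ-χ<0⇒≡ x y q _ with x ≟ q | y ≟ q
  ... | _ | yes y≡q = y≡q
  2χ-χ<0⇒≡ x y q (ℤ.+<+ ()) | yes _ | no _
  2χ-χ<0⇒≡ x y q (ℤ.+<+ ()) | no _ | no _

  _++ᵖ_ : ∀ {P : E G → Set} {x y z} → Path G P x y → Path G P y z → Path G P x z
  []               ++ᵖ q = q
  step e joins P p ++ᵖ q = step e joins P (p ++ᵖ q)

  reverse : ∀ {P : E G → Set} {x y} → Path G P x y → Path G P y x
  reverse []                 = []
  reverse (step e joins P p) = reverse p ++ᵖ step e (swap joins) P []

  Path-map : ∀ {P Q : E G → Set} → (∀ {e} → P e → Q e) → ∀ {x y} → Path G P x y → Path G Q x y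
  Path-map P⇒Q []                 = []
  Path-map P⇒Q (step e joins P p) = step e joins (P⇒Q P) (Path-map P⇒Q p)

  module _ (c : V G → ℤ) where

    Lowerable : V G → V G → Set
    Lowerable x y = HasFactor G (c ⊖χ x ⊖χ y)

    lowerable-sym : ∀ {x y} → Lowerable x y → Lowerable y x
    lowerable-sym {x} {y} = HasFactor-cong λ z → exchange-subtrahends (c z) (χ G x z) (χ G y z)
      where exchange-subtrahends : ∀ C X Y → (C - X) - Y ≡ (C - Y) - X
            exchange-subtrahends = solve-∀

    flexible-lowerable : ∀ {e x y} → Flexible G c e → Joins e x y → x ≢ y → Lowerable x y
    flexible-lowerable ((M , F , Me) , _) joins x≢y = toggle M _ , toggle-factor Sign.- F Me joins x≢y

    Transfers : V G → V G → Set
    Transfers v a = ∀ w → w ≢ v → Lowerable a w → Lowerable v a ⊎ Lowerable v w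

    lowerable-transfers : ∀ {v a} → Lowerable v a → Transfers v a
    lowerable-transfers low _ _ _ = inj₁ low

    module Transfer {v a a′ w : V G} {e : E G} (joins : Joins e a a′) (a≢a′ : a ≢ a′)
                    (v≢a : v ≢ a) (v≢a′ : v ≢ a′) (w≢v : w ≢ v)
                    {M₁ : EdgeSet G} (FM₁ : IsFactor G c M₁) (M₁e : M₁ e ≡ true)
                    {N₁ : EdgeSet G} (FN₁ : IsFactor G (c ⊖χ v ⊖χ a) N₁)
                    {N₂ : EdgeSet G} (FN₂ : IsFactor G (c ⊖χ a′ ⊖χ w) N₂) where

      Goal : Set
      Goal = Lowerable v a′ ⊎ Lowerable v w

      from[c-v+a′] : HasFactor G (c ⊖χ v ⊕χ a′) → Goal
      from[c-v+a′] (R , FR) =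
        outcome (exchange-gap v g FN₂ FR (λ z → gap (c z) (χ G v z) (χ G a′ z) (χ G w z)) g[v]≡0)
        where
        g : V G → ℤ
        g z = - ((χ G a′ z + χ G a′ z) + χ G w z)
        gap : ∀ C V A′ W → (((C - A′) - W) - V) - ((C - V) + A′) ≡ - ((A′ + A′) + W)
        gap = solve-∀
        g[v]≡0 : g v ≡ 0ℤ
        g[v]≡0 rewrite χ-≢ (v≢a′ ∘ sym) | χ-≢ w≢v = refl
        raise-at : ∀ {q} → a′ ≡ q ⊎ w ≡ q → HasFactor G (c ⊖χ a′ ⊖χ w ⊖χ v ⊕χ q) → Goal
        raise-at (inj₁ refl) = inj₂ ∘ HasFactor-cong (λ z → cancel (c z) (χ G v z) (χ G a′ z) (χ G w z))
          where cancel : ∀ C V A′ W → (((C - A′) - W) - V) + A′ ≡ (C - V) - W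
                cancel = solve-∀
        raise-at (inj₂ refl) = inj₁ ∘ HasFactor-cong (λ z → cancel (c z) (χ G v z) (χ G a′ z) (χ G w z))
          where cancel : ∀ C V A′ W → (((C - A′) - W) - V) + W ≡ (C - V) - A′
                cancel = solve-∀
        outcome : GapStep (c ⊖χ a′ ⊖χ w ⊖χ v) g → Goal
        outcome (q , Sign.- , _ , 0<g) = ⊥-elim (ℤP.≤⇒≯ (ℤP.neg-mono-≤ (0≤2χ+χ a′ w q)) 0<g)
        outcome (q , Sign.+ , F , g<0) = raise-at (0<2χ+χ⇒≡ a′ w q (ℤP.neg-cancel-< g<0)) F

      from[c+a-a′]and[c-v-a-a-a′] : HasFactor G (c ⊕χ a ⊖χ a′) →
                                    HasFactor G (c ⊖χ v ⊖χ a ⊖χ a ⊖χ a′) → Goal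
      from[c+a-a′]and[c-v-a-a-a′] (U , FU) (T , FT) =
        outcome (exchange-gap v g FU FT (λ z → gap (c z) (χ G v z) (χ G a z) (χ G a′ z)) g[v]≡0)
        where
        g : V G → ℤ
        g z = (χ G a z + χ G a z) + χ G a z
        gap : ∀ C V A A′ → (((C + A) - A′) - V) - ((((C - V) - A) - A) - A′) ≡ (A + A) + A
        gap = solve-∀
        g[v]≡0 : g v ≡ 0ℤ
        g[v]≡0 rewrite χ-≢ (v≢a ∘ sym) = refl
        lower-at : ∀ {q} → a ≡ q → HasFactor G (c ⊕χ a ⊖χ a′ ⊖χ v ⊖χ q) → Goal
        lower-at refl = inj₁ ∘ HasFactor-cong (λ z → cancel (c z) (χ G v z) (χ G a z) (χ G a′ z))
          where cancel : ∀ C V A A′ → (((C + A) - A′) - V) - A ≡ (C - V) - A′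
                cancel = solve-∀
        outcome : GapStep (c ⊕χ a ⊖χ a′ ⊖χ v) g → Goal
        outcome (q , Sign.- , F , 0<g) = lower-at (reduce (0<2χ+χ⇒≡ a a q 0<g)) F
        outcome (q , Sign.+ , _ , g<0) = ⊥-elim (ℤP.≤⇒≯ (0≤2χ+χ a a q) g<0)

      from[c-v+a]and[c-v-a-a-a′] : HasFactor G (c ⊖χ v ⊕χ a) →
                                   HasFactor G (c ⊖χ v ⊖χ a ⊖χ a ⊖χ a′) → Goal
      from[c-v+a]and[c-v-a-a-a′] (W , FW) T =
        outcome (exchange-gap a′ g FW FM₁′ (λ z → gap (c z) (χ G v z) (χ G a z) (χ G a′ z)) g[a′]≡0)
        where
        FM₁′ : IsFactor G (c ⊖χ a ⊖χ a′) (toggle M₁ e)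
        FM₁′ = toggle-factor Sign.- FM₁ M₁e joins a≢a′
        g : V G → ℤ
        g z = (χ G a z + χ G a z) - χ G v z
        gap : ∀ C V A A′ → (((C - V) + A) - A′) - ((C - A) - A′) ≡ (A + A) - V
        gap = solve-∀
        g[a′]≡0 : g a′ ≡ 0ℤ
        g[a′]≡0 rewrite χ-≢ a≢a′ | χ-≢ v≢a′ = refl
        lower-at : ∀ {q} → a ≡ q → HasFactor G (c ⊖χ v ⊕χ a ⊖χ a′ ⊖χ q) → Goal
        lower-at refl = inj₁ ∘ HasFactor-cong (λ z → cancel (c z) (χ G v z) (χ G a z) (χ G a′ z))
          where cancel : ∀ C V A A′ → (((C - V) + A) - A′) - A ≡ (C - V) - A′
                cancel = solve-∀
        raise-at : ∀ {q} → v ≡ q → HasFactor G (c ⊖χ v ⊕χ a ⊖χ a′ ⊕χ q) → Goal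
        raise-at refl U = from[c+a-a′]and[c-v-a-a-a′]
                            (HasFactor-cong (λ z → cancel (c z) (χ G v z) (χ G a z) (χ G a′ z)) U) T
          where cancel : ∀ C V A A′ → (((C - V) + A) - A′) + V ≡ (C + A) - A′
                cancel = solve-∀
        outcome : GapStep (c ⊖χ v ⊕χ a ⊖χ a′) g → Goal
        outcome (q , Sign.- , F , 0<g) = lower-at (0<2χ-χ⇒≡ a v q 0<g) F
        outcome (q , Sign.+ , F , g<0) = raise-at (2χ-χ<0⇒≡ a v q g<0) F

      from[c-v+a] : HasFactor G (c ⊖χ v ⊕χ a) → Goal
      from[c-v+a] W = by-membership (N₁ e) refl
        where
        by-membership : ∀ b → N₁ e ≡ b → Goal
        by-membership false N₁e =
          from[c-v+a′] (HasFactor-cong (λ z → cancel (c z) (χ G v z) (χ G a z) (χ G a′ z))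
                         (toggle N₁ e , toggle-factor Sign.+ FN₁ N₁e joins a≢a′))
          where cancel : ∀ C V A A′ → (((C - V) - A) + A) + A′ ≡ (C - V) + A′
                cancel = solve-∀
        by-membership true N₁e =
          from[c-v+a]and[c-v-a-a-a′] W (toggle N₁ e , toggle-factor Sign.- FN₁ N₁e joins a≢a′)

      from[c+a+a′] : HasFactor G (c ⊕χ a ⊕χ a′) → Goal
      from[c+a+a′] (P , FP) =
        outcome (exchange-gap v g FP FN₁ (λ z → gap (c z) (χ G v z) (χ G a z) (χ G a′ z)) g[v]≡0)
        where
        g : V G → ℤ
        g z = (χ G a z + χ G a z) + χ G a′ z
        gap : ∀ C V A A′ → (((C + A) + A′) - V) - ((C - V) - A) ≡ (A + A) + A′
        gap = solve-∀
        g[v]≡0 : g v ≡ 0ℤ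
        g[v]≡0 rewrite χ-≢ (v≢a ∘ sym) | χ-≢ (v≢a′ ∘ sym) = refl
        lower-at : ∀ {q} → a ≡ q ⊎ a′ ≡ q → HasFactor G (c ⊕χ a ⊕χ a′ ⊖χ v ⊖χ q) → Goal
        lower-at (inj₁ refl) = from[c-v+a′] ∘ HasFactor-cong (λ z → cancel (c z) (χ G v z) (χ G a z) (χ G a′ z))
          where cancel : ∀ C V A A′ → (((C + A) + A′) - V) - A ≡ (C - V) + A′
                cancel = solve-∀
        lower-at (inj₂ refl) = from[c-v+a] ∘ HasFactor-cong (λ z → cancel (c z) (χ G v z) (χ G a z) (χ G a′ z))
          where cancel : ∀ C V A A′ → (((C + A) + A′) - V) - A′ ≡ (C - V) + A
                cancel = solve-∀
        outcome : GapStep (c ⊕χ a ⊕χ a′ ⊖χ v) g → Goal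
        outcome (q , Sign.- , F , 0<g) = lower-at (0<2χ+χ⇒≡ a a′ q 0<g) F
        outcome (q , Sign.+ , _ , g<0) = ⊥-elim (ℤP.≤⇒≯ (0≤2χ+χ a a′ q) g<0)

    transfers-across : ∀ {v a a′ e} → Flexible G c e → Joins e a a′ → a ≢ a′ → v ≢ a → v ≢ a′ →
                       Lowerable v a → Transfers v a′
    transfers-across ((M₁ , FM₁ , M₁e) , (M₂ , FM₂ , M₂e)) joins a≢a′ v≢a v≢a′
                     (_ , FN₁) w w≢v (_ , FN₂) =
      Transfer.from[c+a+a′] joins a≢a′ v≢a v≢a′ w≢v FM₁ M₁e FN₁ FN₂
        (toggle M₂ _ , toggle-factor Sign.+ FM₂ M₂e joins a≢a′)

    transfers-step : ∀ {v a a′ e} → Flexible G c e → Joins e a a′ →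
                     ReflClosure Transfers v a → ReflClosure Transfers v a′
    transfers-step {v} {a} {a′} flexible joins t with a′ ≟ v | a ≟ v | a ≟ a′
    ... | yes refl | _        | _        = refl
    ... | no a′≢v  | yes refl | _        = [ lowerable-transfers (flexible-lowerable flexible joins (a′≢v ∘ sym)) ]
    ... | no _     | no _     | yes refl = t
    ... | no a′≢v  | no a≢v   | no a≢a′  with t
    ...   | refl = ⊥-elim (a≢v refl)
    ...   | [ T ] with T a′ a′≢v (flexible-lowerable flexible joins a≢a′)
    ...     | inj₁ low[v,a]  = [ transfers-across flexible joins a≢a′ (a≢v ∘ sym) (a′≢v ∘ sym) low[v,a] ]
    ...     | inj₂ low[v,a′] = [ lowerable-transfers low[v,a′] ]

    transfers-along : ∀ {v a b} → Path G (Flexible G c) a b →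
                      ReflClosure Transfers v a → ReflClosure Transfers v b
    transfers-along []                       t = t
    transfers-along (step _ joins flexible p) t = transfers-along p (transfers-step flexible joins t)

    Sim⁻ : V G → V G → Set
    Sim⁻ u v = u ≡ v ⊎ (FlexiblyConnected G c u v × ¬ Lowerable u v)

    unlowerable-trans : ∀ {i j k} → i ≢ j → k ≢ j → Path G (Flexible G c) j i →
                        ¬ Lowerable i j → ¬ Lowerable j k → ¬ Lowerable i k
    unlowerable-trans i≢j k≢j p ¬ij ¬jk low[i,k] with transfers-along p refl
    ... | refl = i≢j refl
    ... | [ T ] with T _ k≢j low[i,k]
    ...   | inj₁ low[j,i] = ¬ij (lowerable-sym low[j,i])
    ...   | inj₂ low[j,k] = ¬jk low[j,k]

    Sim⁻-isEquivalence : IsEquivalence Sim⁻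
    Sim⁻-isEquivalence = record { refl = inj₁ refl ; sym = Sim⁻-sym ; trans = Sim⁻-trans }
      where
      Sim⁻-sym : Symmetric Sim⁻
      Sim⁻-sym (inj₁ u≡v)       = inj₁ (sym u≡v)
      Sim⁻-sym (inj₂ (p , ¬uv)) = inj₂ (reverse p , ¬uv ∘ lowerable-sym)
      Sim⁻-trans : Transitive Sim⁻
      Sim⁻-trans (inj₁ refl) r = r
      Sim⁻-trans r (inj₁ refl) = r
      Sim⁻-trans {i} {j} {k} (inj₂ (p , ¬ij)) (inj₂ (q , ¬jk)) with i ≟ j | j ≟ k
      ... | yes refl | _        = inj₂ (q , ¬jk)
      ... | no _     | yes refl = inj₂ (p , ¬ij)
      ... | no i≢j   | no j≢k   = inj₂ (p ++ᵖ q , unlowerable-trans i≢j (j≢k ∘ sym) (reverse p) ¬ij ¬jk)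

  fullDegree : V G → ℤ
  fullDegree z = + degIn G (λ _ → true) z

  degIn-complement : ∀ M z → degIn G (not ∘ M) z ℕ.+ degIn G M z ≡ degIn G (λ _ → true) z
  degIn-complement M z = begin
    degIn G (not ∘ M) z ℕ.+ degIn G M z
      ≡⟨ cong₂ ℕ._+_ (degIn≡count (not ∘ M) z) (degIn≡count M z) ⟩
    count (m G) (λ e → not (M e) ∧ inδ G z e) ℕ.+ count (m G) (λ e → M e ∧ inδ G z e)
      ≡⟨ count-partition M (inδ G z) ⟩
    count (m G) (inδ G z)
      ≡⟨ degIn≡count (λ _ → true) z ⟨
    degIn G (λ _ → true) z ∎
    where open ≡-Reasoning

  complement-factor : ∀ {c M} → IsFactor G c M → IsFactor G (fullDegree ⊖ c) (not ∘ M)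
  complement-factor {c} {M} F z = begin
    + degIn G (not ∘ M) z
      ≡⟨ add-subtract _ (+ degIn G M z) ⟩
    (+ degIn G (not ∘ M) z + + degIn G M z) - + degIn G M z
      ≡⟨ cong₂ _-_ (cong +_ (degIn-complement M z)) (F z) ⟩
    fullDegree z - c z ∎
    where
    open ≡-Reasoning
    add-subtract : ∀ a b → a ≡ (a + b) - b
    add-subtract = solve-∀

  complement-involutive : ∀ c → fullDegree ⊖ (fullDegree ⊖ c) ≗ c
  complement-involutive c z = subtract-twice (fullDegree z) (c z)
    where subtract-twice : ∀ d a → d - (d - a) ≡ a
          subtract-twice = solve-∀

  Flexible-cong : ∀ {c c′ e} → c ≗ c′ → Flexible G c e → Flexible G c′ e
  Flexible-cong c≗c′ ((M₁ , F₁ , M₁e) , (M₂ , F₂ , M₂e)) =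
    (M₁ , IsFactor-cong c≗c′ F₁ , M₁e) , (M₂ , IsFactor-cong c≗c′ F₂ , M₂e)

  flexible-complement : ∀ {c e} → Flexible G c e → Flexible G (fullDegree ⊖ c) e
  flexible-complement ((M₁ , F₁ , M₁e) , (M₂ , F₂ , M₂e)) =
    (not ∘ M₂ , complement-factor F₂ , cong not M₂e) , (not ∘ M₁ , complement-factor F₁ , cong not M₁e)

  flexible-uncomplement : ∀ {c e} → Flexible G (fullDegree ⊖ c) e → Flexible G c e
  flexible-uncomplement {c} = Flexible-cong (complement-involutive c) ∘ flexible-complement

  module _ (c : V G → ℤ) where

    Sim⁺ : V G → V G → Set
    Sim⁺ u v = u ≡ v ⊎ (FlexiblyConnected G c u v × ¬ HasFactor G (c ⊕χ u ⊕χ v))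

    raisable⇒lowerable-complement : ∀ {u v} → HasFactor G (c ⊕χ u ⊕χ v) → Lowerable (fullDegree ⊖ c) u v
    raisable⇒lowerable-complement {u} {v} (M , F) =
      not ∘ M , IsFactor-cong (λ z → distribute (fullDegree z) (c z) (χ G u z) (χ G v z)) (complement-factor F)
      where distribute : ∀ d a x y → d - ((a + x) + y) ≡ ((d - a) - x) - y
            distribute = solve-∀

    lowerable-complement⇒raisable : ∀ {u v} → Lowerable (fullDegree ⊖ c) u v → HasFactor G (c ⊕χ u ⊕χ v)
    lowerable-complement⇒raisable {u} {v} (M , F) =
      not ∘ M , IsFactor-cong (λ z → distribute (fullDegree z) (c z) (χ G u z) (χ G v z)) (complement-factor F)
      where distribute : ∀ d a x y → d - (((d - a) - x) - y) ≡ (a + x) + y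
            distribute = solve-∀

    Sim⁺⇒Sim⁻ : ∀ {u v} → Sim⁺ u v → Sim⁻ (fullDegree ⊖ c) u v
    Sim⁺⇒Sim⁻ (inj₁ u≡v)       = inj₁ u≡v
    Sim⁺⇒Sim⁻ (inj₂ (p , ¬uv)) =
      inj₂ (Path-map flexible-complement p , ¬uv ∘ lowerable-complement⇒raisable)

    Sim⁻⇒Sim⁺ : ∀ {u v} → Sim⁻ (fullDegree ⊖ c) u v → Sim⁺ u v
    Sim⁻⇒Sim⁺ (inj₁ u≡v)       = inj₁ u≡v
    Sim⁻⇒Sim⁺ (inj₂ (p , ¬uv)) =
      inj₂ (Path-map flexible-uncomplement p , ¬uv ∘ raisable⇒lowerable-complement)

    Sim⁺-isEquivalence : IsEquivalence Sim⁺
    Sim⁺-isEquivalence = record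
      { refl  = inj₁ refl
      ; sym   = Sim⁻⇒Sim⁺ ∘ IsEquivalence.sym S ∘ Sim⁺⇒Sim⁻
      ; trans = λ r s → Sim⁻⇒Sim⁺ (IsEquivalence.trans S (Sim⁺⇒Sim⁻ r) (Sim⁺⇒Sim⁻ s))
      }
      where
      S : IsEquivalence (Sim⁻ (fullDegree ⊖ c))
      S = Sim⁻-isEquivalence (fullDegree ⊖ c)

theorem6p4 : (G : Graph) (b : V G → ℕ) → HasFactor G (toℤ G b) →
    IsEquivalence (SimMinus G b) × IsEquivalence (SimPlus G b)
theorem6p4 G b _ = Sim⁻-isEquivalence G (toℤ G b) , Sim⁺-isEquivalence G (toℤ G b)
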